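{- For the game $CSG(\{1,2,4\})$ and every integer $k\ge 0$, $\mathcal{G}(S_{1,2,k})=|S_{1,2,k}|\bmod 3=(k+4)\bmod 3$.
   Context: For a set $L$ of positive integers, the game $CSG(L)$ on a connected graph $G$ is the two-player impartial game in which a move consists in removing from the current graph a connected subgraph $H$ such that $|V(H)|\in L$ and the remaining graph is connected (the empty graph counts as connected, so removing the whole graph is allowed when its size is in $L$). The player unable to move loses. $\mathcal{G}(G)$ is the Grundy value of $CSG(\{1,2,4\})$ on $G$. The subdivided star $S_{\ell_1,\ldots,\ell_t}$ is obtained from a central vertex by attaching $t$ disjoint paths with $\ell_1,\ldots,\ell_t$ vertices (paths with $0$ vertices allowed); $|G|$ is the number of vertices. -}

module Defs where

open import Data.Nat using (ℕ; zero; suc; _+_; _<_)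
open import Data.List using (List; []; _∷_)
open import Data.Fin using (Fin; toℕ)
open import Data.Fin.Subset using (Subset; _∈_; _⊆_; _─_; ∣_∣)
open import Data.Product using (Σ; ∃; _×_; _,_)
open import Data.Sum using (_⊎_)
open import Relation.Binary.PropositionalEquality using (_≡_; _≢_)

record Graph : Set₁ where
  field
    n   : ℕ
    Adj : Fin n → Fin n → Set
open Graph public

module _ (G : Graph) where
  private
    N = n G
    A = Adj G

  -- Walks from u to v all of whose vertices (after u) lie in S.
  data WalkIn (S : Subset N) : Fin N → Fin N → Set where
    here : ∀ {u} → WalkIn S u u
    step : ∀ {u w v} → A u w → w ∈ S → WalkIn S w v → WalkIn S u v

  -- The subgraph induced by S is connected (the empty graph counts as connected).
  Connected : Subset N → Set
  Connected S = ∀ u v → u ∈ S → v ∈ S → WalkIn S u v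

  -- A legal move of CSG(L) from position S (a vertex set inducing the current
  -- graph): remove a vertex set T ⊆ S with |T| ∈ L, T inducing a connected
  -- subgraph and S ─ T inducing a connected graph.
  Move : (ℕ → Set) → Subset N → Subset N → Set
  Move L S T = T ⊆ S × L ∣ T ∣ × Connected T × Connected (S ─ T)

  data HasGrundy (L : ℕ → Set) : Subset N → ℕ → Set where
    mex : ∀ {S v}
        → (∀ T → Move L S T → ∃ λ w → HasGrundy L (S ─ T) w × w ≢ v)
        → (∀ u → u < v → ∃ λ T → Move L S T × HasGrundy L (S ─ T) u)
        → HasGrundy L S v

L124 : ℕ → Set
L124 m = m ≡ 1 ⊎ (m ≡ 2 ⊎ m ≡ 4)

-- Subdivided star S_{ℓ1,...,ℓt}: vertex 0 is the centre; arm i occupies the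
-- consecutive vertices base, base+1, ..., base+ℓi-1 where base = 1 + ℓ1+...+ℓ(i-1);
-- the centre is joined to the first vertex of each nonempty arm, and consecutive
-- vertices of an arm are joined.
data ArmEdge : List ℕ → ℕ → ℕ → ℕ → Set where
  centre : ∀ {ℓ ls base} → 0 < ℓ → ArmEdge (ℓ ∷ ls) base 0 base
  along  : ∀ {ℓ ls base} j → suc j < ℓ → ArmEdge (ℓ ∷ ls) base (base + j) (base + suc j)
  later  : ∀ {ℓ ls base u v} → ArmEdge ls (base + ℓ) u v → ArmEdge (ℓ ∷ ls) base u v

sumL : List ℕ → ℕ
sumL []       = 0
sumL (x ∷ xs) = x + sumL xs

SubdividedStar : List ℕ → Graph
SubdividedStar ls = record
  { n   = suc (sumL ls)
  ; Adj = λ u v → ArmEdge ls 1 (toℕ u) (toℕ v) ⊎ ArmEdge ls 1 (toℕ v) (toℕ u)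
  }

𝒢≡ : Graph → ℕ → Set
𝒢≡ G v = HasGrundy G L124 Data.Fin.Subset.⊤ v

-- Every move of CSG({1,2,4}) removes 1, 2 or 4 vertices, none a multiple of 3, so it changes the
-- number of remaining vertices modulo 3. Conversely, in S_{1,2,k} one can always remove a single
-- leaf, and, when the size is 2 modulo 3, two adjacent vertices (the arm 2-3, or the last vertex
-- of the long arm together with its neighbour). Induction on the size then gives G(S) = |S| mod 3
-- for every connected position S.
module Submission where

open import Data.Fin using (Fin; zero; suc; toℕ; fromℕ<)
import Data.Fin as Fin
open import Data.Fin.Properties using (toℕ-injective; toℕ<n; toℕ-fromℕ<)
open import Data.Fin.Induction using () renaming (<-wellFounded to Fin-<-wellFounded)
open import Data.Fin.Subset
  using (Subset; inside; outside; _∈_; _∉_; _⊆_; _─_; _∪_; ⁅_⁆; ∣_∣; ⊤; ⊥; Nonempty)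
open import Data.Fin.Subset.Properties
open import Data.List using ([]; _∷_)
open import Data.Nat
  using (ℕ; zero; suc; _+_; _*_; _∸_; _%_; _/_; _≤_; _<_; _≤?_; NonZero; z≤n; s≤s; s≤s⁻¹)
open import Data.Nat.DivMod
open import Data.Nat.Induction using (<-wellFounded)
open import Data.Nat.Properties
open import Data.Product using (∃; _×_; _,_; proj₂)
open import Data.Sum using (_⊎_; inj₁; inj₂; [_,_]′)
open import Data.Vec using ([]; _∷_; here; there)
open import Function using (_∘_)
open import Induction.WellFounded using (Acc; acc)
open import Relation.Binary.Definitions using (Symmetric)
open import Relation.Binary.PropositionalEquality
open import Relation.Nullary using (¬_; yes; no; contradiction)

open import Defs

open ≡-Reasoning

[m+n]%d≡m%d⇒n%d≡0 : ∀ m n d .{{_ : NonZero d}} → (m + n) % d ≡ m % d → n % d ≡ 0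
[m+n]%d≡m%d⇒n%d≡0 m n d eq = begin
  n % d                                                     ≡⟨ %-congˡ (m+n∸m≡n m n) ⟨
  (m + n ∸ m) % d
    ≡⟨ %-congˡ (cong₂ _∸_ (m≡m%n+[m/n]*n (m + n) d) (m≡m%n+[m/n]*n m d)) ⟩
  ((m + n) % d + (m + n) / d * d ∸ (m % d + m / d * d)) % d
    ≡⟨ %-congˡ (cong (λ r → r + (m + n) / d * d ∸ (m % d + m / d * d)) eq) ⟩
  (m % d + (m + n) / d * d ∸ (m % d + m / d * d)) % d       ≡⟨ %-congˡ ([m+n]∸[m+o]≡n∸o (m % d) _ _) ⟩
  ((m + n) / d * d ∸ m / d * d) % d                         ≡⟨ %-congˡ (*-distribʳ-∸ d ((m + n) / d) (m / d)) ⟨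
  ((m + n) / d ∸ m / d) * d % d                             ≡⟨ m*n%n≡0 ((m + n) / d ∸ m / d) d ⟩
  0                                                         ∎

[m∸n]%d≡m%d∸n : ∀ m {n} d .{{_ : NonZero d}} → n ≤ m % d → (m ∸ n) % d ≡ m % d ∸ n
[m∸n]%d≡m%d∸n m {n} d n≤m%d = begin
  (m ∸ n) % d                 ≡⟨ %-congˡ (cong (_∸ n) (m≡m%n+[m/n]*n m d)) ⟩
  (m % d + m / d * d ∸ n) % d ≡⟨ %-congˡ (+-∸-comm (m / d * d) n≤m%d) ⟩
  (m % d ∸ n + m / d * d) % d ≡⟨ [m+kn]%n≡m%n (m % d ∸ n) (m / d) d ⟩
  (m % d ∸ n) % d             ≡⟨ m<n⇒m%n≡m (≤-<-trans (m∸n≤m (m % d) n) (m%n<n m d)) ⟩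
  m % d ∸ n                   ∎

x∈p─q⇒x∉q : ∀ {n} {x : Fin n} (p q : Subset n) → x ∈ p ─ q → x ∉ q
x∈p─q⇒x∉q (inside ∷ p) (outside ∷ q) here ()
x∈p─q⇒x∉q (_ ∷ p)      (_ ∷ q)       (there x∈p─q) (there x∈q) = x∈p─q⇒x∉q p q x∈p─q x∈q

∣p─q∣+∣q∣≡∣p∣ : ∀ {n} {p q : Subset n} → q ⊆ p → ∣ p ─ q ∣ + ∣ q ∣ ≡ ∣ p ∣
∣p─q∣+∣q∣≡∣p∣ {p = []}          {[]}          _   = refl
∣p─q∣+∣q∣≡∣p∣ {p = inside ∷ p}  {inside ∷ q}  q⊆p =
  trans (+-suc ∣ p ─ q ∣ ∣ q ∣) (cong suc (∣p─q∣+∣q∣≡∣p∣ (drop-∷-⊆ q⊆p)))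
∣p─q∣+∣q∣≡∣p∣ {p = inside ∷ p}  {outside ∷ q} q⊆p = cong suc (∣p─q∣+∣q∣≡∣p∣ (drop-∷-⊆ q⊆p))
∣p─q∣+∣q∣≡∣p∣ {p = outside ∷ p} {outside ∷ q} q⊆p = ∣p─q∣+∣q∣≡∣p∣ (drop-∷-⊆ q⊆p)
∣p─q∣+∣q∣≡∣p∣ {p = outside ∷ p} {inside ∷ q}  q⊆p with () ← q⊆p here

x∈p⇒⁅x⁆⊆p : ∀ {n} {p : Subset n} {x} → x ∈ p → ⁅ x ⁆ ⊆ p
x∈p⇒⁅x⁆⊆p {p = p} {x} x∈p y∈⁅x⁆ = subst (_∈ p) (sym (x∈⁅y⁆⇒x≡y x y∈⁅x⁆)) x∈p

1+∣p─⁅x⁆∣≡∣p∣ : ∀ {n} {p : Subset n} {x} → x ∈ p → suc ∣ p ─ ⁅ x ⁆ ∣ ≡ ∣ p ∣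
1+∣p─⁅x⁆∣≡∣p∣ {p = p} {x} x∈p = begin
  suc ∣ p ─ ⁅ x ⁆ ∣           ≡⟨ +-comm 1 ∣ p ─ ⁅ x ⁆ ∣ ⟩
  ∣ p ─ ⁅ x ⁆ ∣ + 1           ≡⟨ cong (∣ p ─ ⁅ x ⁆ ∣ +_) (∣⁅x⁆∣≡1 x) ⟨
  ∣ p ─ ⁅ x ⁆ ∣ + ∣ ⁅ x ⁆ ∣   ≡⟨ ∣p─q∣+∣q∣≡∣p∣ (x∈p⇒⁅x⁆⊆p x∈p) ⟩
  ∣ p ∣                       ∎

∣⁅x⁆∪⁅y⁆∣≡2 : ∀ {n} {x y : Fin n} → x ≢ y → ∣ ⁅ x ⁆ ∪ ⁅ y ⁆ ∣ ≡ 2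
∣⁅x⁆∪⁅y⁆∣≡2 {x = zero}  {zero}  x≢y = contradiction refl x≢y
∣⁅x⁆∪⁅y⁆∣≡2 {x = zero}  {suc y} _   = cong suc (trans (cong ∣_∣ (∪-identityˡ ⁅ y ⁆)) (∣⁅x⁆∣≡1 y))
∣⁅x⁆∪⁅y⁆∣≡2 {x = suc x} {zero}  _   = cong suc (trans (cong ∣_∣ (∪-identityʳ ⁅ x ⁆)) (∣⁅x⁆∣≡1 x))
∣⁅x⁆∪⁅y⁆∣≡2 {x = suc x} {suc y} x≢y = ∣⁅x⁆∪⁅y⁆∣≡2 (x≢y ∘ cong suc)

x∈⁅y⁆∪⁅z⁆⇒x≡y⊎x≡z : ∀ {n} {x y z : Fin n} → x ∈ ⁅ y ⁆ ∪ ⁅ z ⁆ → x ≡ y ⊎ x ≡ z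
x∈⁅y⁆∪⁅z⁆⇒x≡y⊎x≡z {y = y} {z} x∈ with x∈p∪q⁻ ⁅ y ⁆ ⁅ z ⁆ x∈
... | inj₁ x∈⁅y⁆ = inj₁ (x∈⁅y⁆⇒x≡y y x∈⁅y⁆)
... | inj₂ x∈⁅z⁆ = inj₂ (x∈⁅y⁆⇒x≡y z x∈⁅z⁆)

∣p∣>0⇒Nonempty : ∀ {n} {p : Subset n} → 0 < ∣ p ∣ → Nonempty p
∣p∣>0⇒Nonempty {n} {p} ∣p∣>0 with nonempty? p
... | yes ne = ne
... | no ¬ne = contradiction (trans (cong ∣_∣ (Empty-unique ¬ne)) (∣⊥∣≡0 n)) (<⇒≢ ∣p∣>0 ∘ sym)

∃-maximum : ∀ {n} {p : Subset n} → Nonempty p → ∃ λ m → m ∈ p × (∀ {x} → x ∈ p → x Fin.≤ m)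
∃-maximum {p = b ∷ p} (x , x∈p) with nonempty? p
... | yes ne with m , m∈p , max ← ∃-maximum ne =
  suc m , there m∈p , λ { here → z≤n ; (there y∈p) → s≤s (max y∈p) }
... | no ¬ne = zero , zero∈ x x∈p , λ { here → z≤n ; (there y∈p) → contradiction (_ , y∈p) ¬ne }
  where
  zero∈ : ∀ x → x ∈ b ∷ p → zero ∈ b ∷ p
  zero∈ zero    x∈ = x∈
  zero∈ (suc x) x∈ = contradiction (x , drop-there x∈) ¬ne

∃-other-element : ∀ {n} {p : Subset n} {x} → x ∈ p → 2 ≤ ∣ p ∣ → ∃ λ y → y ∈ p × y ≢ x
∃-other-element {p = p} {x} x∈p 2≤∣p∣
  with y , y∈ ← ∣p∣>0⇒Nonempty (s≤s⁻¹ (subst (2 ≤_) (sym (1+∣p─⁅x⁆∣≡∣p∣ x∈p)) 2≤∣p∣)) =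
  y , p─q⊆p p ⁅ x ⁆ y∈ , x∉⁅y⁆⇒x≢y (x∈p─q⇒x∉q p ⁅ x ⁆ y∈)

-- At most one neighbour in S: an isolated vertex counts as pendant too.
Pendant : (G : Graph) → Subset (n G) → Fin (n G) → Set
Pendant G S x = ∀ {y z} → y ∈ S → z ∈ S → Adj G x y → Adj G x z → y ≡ z

record Cut (G : Graph) (S : Subset (n G)) (t : ℕ) : Set where
  field
    removed           : Subset (n G)
    removed⊆S         : removed ⊆ S
    ∣removed∣≡t       : ∣ removed ∣ ≡ t
    removed-connected : Connected G removed
    rest-connected    : Connected G (S ─ removed)

Cut⇒Move : ∀ {G S t} {L : ℕ → Set} → L t → (cut : Cut G S t) → Move G L S (Cut.removed cut)
Cut⇒Move {L = L} Lt cut = removed⊆S , subst L (sym ∣removed∣≡t) Lt , removed-connected , rest-connected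
  where open Cut cut

module _ {G : Graph} where

  _++ʷ_ : ∀ {S u v w} → WalkIn G S u v → WalkIn G S v w → WalkIn G S u w
  here            ++ʷ q = q
  step a w∈S walk ++ʷ q = step a w∈S (walk ++ʷ q)

  ∃-neighbour : ∀ {S x} → Connected G S → x ∈ S → 2 ≤ ∣ S ∣ → ∃ λ w → w ∈ S × Adj G x w
  ∃-neighbour S-conn x∈S 2≤∣S∣ with y , y∈S , y≢x ← ∃-other-element x∈S 2≤∣S∣
                                 | S-conn _ y x∈S y∈S
  ... | here         = contradiction refl y≢x
  ... | step a w∈S _ = _ , w∈S , a

  singleton-connected : ∀ x → Connected G ⁅ x ⁆
  singleton-connected x u v u∈ v∈
    rewrite x∈⁅y⁆⇒x≡y x u∈ | x∈⁅y⁆⇒x≡y x v∈ = here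

  cut-whole : ∀ {S} → Connected G S → Cut G S ∣ S ∣
  cut-whole {S} S-conn = record
    { removed           = S
    ; removed⊆S         = λ x∈S → x∈S
    ; ∣removed∣≡t       = refl
    ; removed-connected = S-conn
    ; rest-connected    = λ u _ u∈ _ → contradiction (p─q⊆p S S u∈) (x∈p─q⇒x∉q S S u∈)
    }

module _ {G : Graph} (Adj-sym : Symmetric (Adj G)) where

  reverseʷ : ∀ {S u v} → u ∈ S → WalkIn G S u v → WalkIn G S v u
  reverseʷ _   here             = here
  reverseʷ u∈S (step a w∈S walk) = reverseʷ w∈S walk ++ʷ step (Adj-sym a) u∈S here

  -- A walk through the pendant vertex x enters and leaves it through its unique neighbour,
  -- so the detour can be cut out.
  avoid-pendant : ∀ {S x u v} → Pendant G S x → u ∈ S → u ≢ x → v ≢ x →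
                  WalkIn G S u v → WalkIn G (S ─ ⁅ x ⁆) u v
  avoid-pendant pendant u∈S u≢x v≢x here = here
  avoid-pendant {x = x} pendant u∈S u≢x v≢x (step {w = w} a w∈S walk) with w Fin.≟ x
  ... | no w≢x = step a (x∈p∧x∉q⇒x∈p─q w∈S (x≢y⇒x∉⁅y⁆ w≢x)) (avoid-pendant pendant w∈S w≢x v≢x walk)
  avoid-pendant pendant u∈S u≢x v≢x (step a _ here) | yes refl = contradiction refl v≢x
  avoid-pendant pendant u∈S u≢x v≢x (step a _ (step a′ w′∈S walk)) | yes refl
    with refl ← pendant u∈S w′∈S (Adj-sym a) a′ = avoid-pendant pendant u∈S u≢x v≢x walk

  Connected-─-pendant : ∀ {S x} → Connected G S → Pendant G S x → Connected G (S ─ ⁅ x ⁆)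
  Connected-─-pendant {S} {x} S-conn pendant u v u∈ v∈ =
    avoid-pendant pendant (p─q⊆p S ⁅ x ⁆ u∈) (x∉⁅y⁆⇒x≢y (x∈p─q⇒x∉q S ⁅ x ⁆ u∈))
      (x∉⁅y⁆⇒x≢y (x∈p─q⇒x∉q S ⁅ x ⁆ v∈)) (S-conn u v (p─q⊆p S ⁅ x ⁆ u∈) (p─q⊆p S ⁅ x ⁆ v∈))

  cut-pendant : ∀ {S x} → Connected G S → x ∈ S → Pendant G S x → Cut G S 1
  cut-pendant {x = x} S-conn x∈S pendant = record
    { removed           = ⁅ x ⁆
    ; removed⊆S         = x∈p⇒⁅x⁆⊆p x∈S
    ; ∣removed∣≡t       = ∣⁅x⁆∣≡1 x
    ; removed-connected = singleton-connected x
    ; rest-connected    = Connected-─-pendant S-conn pendant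
    }

  edge-connected : ∀ {x y} → Adj G x y → Connected G (⁅ x ⁆ ∪ ⁅ y ⁆)
  edge-connected {x} {y} a u v u∈ v∈ with x∈⁅y⁆∪⁅z⁆⇒x≡y⊎x≡z u∈ | x∈⁅y⁆∪⁅z⁆⇒x≡y⊎x≡z v∈
  ... | inj₁ refl | inj₁ refl = here
  ... | inj₁ refl | inj₂ refl = step a (x∈p∪q⁺ (inj₂ (x∈⁅x⁆ y))) here
  ... | inj₂ refl | inj₁ refl = step (Adj-sym a) (x∈p∪q⁺ (inj₁ (x∈⁅x⁆ x))) here
  ... | inj₂ refl | inj₂ refl = here

  cut-pendant-pair : ∀ {S x y} → Connected G S → x ∈ S → y ∈ S → Adj G x y → x ≢ y →
                     Pendant G S x → Pendant G (S ─ ⁅ x ⁆) y → Cut G S 2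
  cut-pendant-pair {S} {x} {y} S-conn x∈S y∈S a x≢y x-pendant y-pendant = record
    { removed           = ⁅ x ⁆ ∪ ⁅ y ⁆
    ; removed⊆S         = λ z∈ → [ x∈p⇒⁅x⁆⊆p x∈S , x∈p⇒⁅x⁆⊆p y∈S ]′ (x∈p∪q⁻ ⁅ x ⁆ ⁅ y ⁆ z∈)
    ; ∣removed∣≡t       = ∣⁅x⁆∪⁅y⁆∣≡2 x≢y
    ; removed-connected = edge-connected a
    ; rest-connected    = subst (Connected G) (p─q─r≡p─q∪r S ⁅ x ⁆ ⁅ y ⁆)
        (Connected-─-pendant (Connected-─-pendant S-conn x-pendant) y-pendant)
    }

  module _ (descend : ∀ v → toℕ v ≢ 0 → ∃ λ u → u Fin.< v × Adj G u v) where

    walk-from-root : ∀ v → Acc Fin._<_ v → ∃ λ r → toℕ r ≡ 0 × WalkIn G ⊤ r v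
    walk-from-root v (acc rec) with toℕ v ≟ 0
    ... | yes v≡0 = v , v≡0 , here
    ... | no v≢0 with u , u<v , a ← descend v v≢0
                 with r , r≡0 , r→u ← walk-from-root u (rec u<v) = r , r≡0 , r→u ++ʷ step a ∈⊤ here

    ⊤-connected : Connected G ⊤
    ⊤-connected u v _ _
      with r , r≡0 , r→u ← walk-from-root u (Fin-<-wellFounded u)
         | r′ , r′≡0 , r′→v ← walk-from-root v (Fin-<-wellFounded v)
      with refl ← toℕ-injective (trans r≡0 (sym r′≡0)) = reverseʷ ∈⊤ r→u ++ʷ r′→v

module _ {G : Graph} {L : ℕ → Set} (L-1 : L 1) (L-2 : L 2) (L⇒%3≢0 : ∀ {t} → L t → t % 3 ≢ 0)
         (cut₁ : ∀ {S} → Connected G S → 0 < ∣ S ∣ → Cut G S 1)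
         (cut₂ : ∀ {S} → Connected G S → ∣ S ∣ % 3 ≡ 2 → Cut G S 2) where

  private
    L⇒>0 : ∀ {t} → L t → 0 < t
    L⇒>0 Lt = n≢0⇒n>0 (λ t≡0 → L⇒%3≢0 Lt (cong (_% 3) t≡0))

    grundy-acc : ∀ {S} → Acc _<_ ∣ S ∣ → Connected G S → HasGrundy G L S (∣ S ∣ % 3)
    grundy-acc {S} (acc rec) S-conn = mex options-≢ options-below
      where
      grundy-option : ∀ {T} → Move G L S T → HasGrundy G L (S ─ T) (∣ S ─ T ∣ % 3)
      grundy-option {T} (T⊆S , LT , _ , rest-conn) =
        grundy-acc (rec (subst (∣ S ─ T ∣ <_) (∣p─q∣+∣q∣≡∣p∣ T⊆S) (m<m+n ∣ S ─ T ∣ (L⇒>0 LT)))) rest-conn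

      options-≢ : ∀ T → Move G L S T → ∃ λ w → HasGrundy G L (S ─ T) w × w ≢ ∣ S ∣ % 3
      options-≢ T move@(T⊆S , LT , _) = _ , grundy-option move , λ eq →
        L⇒%3≢0 LT ([m+n]%d≡m%d⇒n%d≡0 ∣ S ─ T ∣ ∣ T ∣ 3
          (trans (cong (_% 3) (∣p─q∣+∣q∣≡∣p∣ T⊆S)) (sym eq)))

      reach : ∀ {u t} → L t → ∣ S ∣ % 3 ≡ u + t → Cut G S t →
              ∃ λ T → Move G L S T × HasGrundy G L (S ─ T) u
      reach {u} {t} Lt ∣S∣%3≡u+t cut =
        removed , move , subst (HasGrundy G L (S ─ removed)) ∣S─T∣%3≡u (grundy-option move)
        where
        open Cut cut
        move : Move G L S removed
        move = Cut⇒Move Lt cut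
        ∣S─T∣+t≡∣S∣ : ∣ S ─ removed ∣ + t ≡ ∣ S ∣
        ∣S─T∣+t≡∣S∣ = trans (cong (∣ S ─ removed ∣ +_) (sym ∣removed∣≡t)) (∣p─q∣+∣q∣≡∣p∣ removed⊆S)
        ∣S─T∣%3≡u : ∣ S ─ removed ∣ % 3 ≡ u
        ∣S─T∣%3≡u = begin
          ∣ S ─ removed ∣ % 3              ≡⟨ %-congˡ (m+n∸n≡m ∣ S ─ removed ∣ t) ⟨
          (∣ S ─ removed ∣ + t ∸ t) % 3    ≡⟨ %-congˡ (cong (_∸ t) ∣S─T∣+t≡∣S∣) ⟩
          (∣ S ∣ ∸ t) % 3                  ≡⟨ [m∸n]%d≡m%d∸n ∣ S ∣ 3 (subst (t ≤_) (sym ∣S∣%3≡u+t) (m≤n+m t u)) ⟩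
          ∣ S ∣ % 3 ∸ t                    ≡⟨ cong (_∸ t) ∣S∣%3≡u+t ⟩
          u + t ∸ t                        ≡⟨ m+n∸n≡m u t ⟩
          u                                ∎

      ∣S∣>0 : ∀ {r} → ∣ S ∣ % 3 ≡ suc r → 0 < ∣ S ∣
      ∣S∣>0 ∣S∣%3≡1+r = n≢0⇒n>0 (λ ∣S∣≡0 → 0≢1+n (trans (sym (cong (_% 3) ∣S∣≡0)) ∣S∣%3≡1+r))

      options-below : ∀ u → u < ∣ S ∣ % 3 → ∃ λ T → Move G L S T × HasGrundy G L (S ─ T) u
      options-below u u<r with ∣ S ∣ % 3 in r≡
      options-below 0             _              | 1 = reach L-1 r≡ (cut₁ S-conn (∣S∣>0 r≡))
      options-below 0             _              | 2 = reach L-2 r≡ (cut₂ S-conn r≡)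
      options-below 1             _              | 2 = reach L-1 r≡ (cut₁ S-conn (∣S∣>0 r≡))
      options-below (suc _)       (s≤s ())       | 1
      options-below (suc (suc _)) (s≤s (s≤s ())) | 2
      options-below u u<r | suc (suc (suc r)) =
        contradiction (subst (_< 3) r≡ (m%n<n ∣ S ∣ 3)) λ { (s≤s (s≤s (s≤s ()))) }

  grundy≡∣S∣%3 : ∀ {S} → Connected G S → HasGrundy G L S (∣ S ∣ % 3)
  grundy≡∣S∣%3 = grundy-acc (<-wellFounded _)

IsParent : (ℕ → ℕ) → ℕ → ℕ → Set
IsParent parent a b = a ≡ parent b × a < b

module ParentLabelled {G : Graph} (Adj-sym : Symmetric (Adj G)) (parent : ℕ → ℕ)
  (Adj⇒IsParent : ∀ {u v} → Adj G u v →
                  IsParent parent (toℕ u) (toℕ v) ⊎ IsParent parent (toℕ v) (toℕ u)) where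

  Childless : Subset (n G) → Fin (n G) → Set
  Childless S x = ∀ {z} → z ∈ S → ¬ IsParent parent (toℕ x) (toℕ z)

  Childless⇒Pendant : ∀ {S x} → Childless S x → Pendant G S x
  Childless⇒Pendant {S} {x} childless y∈S z∈S x~y x~z =
    toℕ-injective (trans (to-parent y∈S x~y) (sym (to-parent z∈S x~z)))
    where
    to-parent : ∀ {y} → y ∈ S → Adj G x y → toℕ y ≡ parent (toℕ x)
    to-parent y∈S x~y with Adj⇒IsParent x~y
    ... | inj₁ x-parent-of-y = contradiction x-parent-of-y (childless y∈S)
    ... | inj₂ (y≡parent , _) = y≡parent

  maximum-Childless : ∀ {S m} → (∀ {z} → z ∈ S → z Fin.≤ m) → Childless S m
  maximum-Childless max z∈S (_ , m<z) = <⇒≱ m<z (max z∈S)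

  OnlyChild : Fin (n G) → Set
  OnlyChild x = ∀ b → parent b ≡ parent (toℕ x) → b ≡ toℕ x

  only-child-Childless : ∀ {S w x} → toℕ w ≡ parent (toℕ x) → OnlyChild x → Childless (S ─ ⁅ x ⁆) w
  only-child-Childless {S} {x = x} w≡parent only-child {z} z∈ (w≡parent-z , _) =
    x∉⁅y⁆⇒x≢y (x∈p─q⇒x∉q S ⁅ x ⁆ z∈) (toℕ-injective (only-child (toℕ z) (trans (sym w≡parent-z) w≡parent)))

  cut-maximum : ∀ {S} → Connected G S → 0 < ∣ S ∣ → Cut G S 1
  cut-maximum S-conn ∣S∣>0 with m , m∈S , max ← ∃-maximum (∣p∣>0⇒Nonempty ∣S∣>0) =
    cut-pendant Adj-sym S-conn m∈S (Childless⇒Pendant (maximum-Childless max))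

  cut-leaf-and-parent : ∀ {S x} → Connected G S → x ∈ S → 2 ≤ ∣ S ∣ → Childless S x → OnlyChild x →
                        Cut G S 2
  cut-leaf-and-parent S-conn x∈S 2≤∣S∣ x-childless only-child
    with w , w∈S , x~w ← ∃-neighbour S-conn x∈S 2≤∣S∣ | Adj⇒IsParent x~w
  ... | inj₁ x-parent-of-w = contradiction x-parent-of-w (x-childless w∈S)
  ... | inj₂ (w≡parent , w<x) =
    cut-pendant-pair Adj-sym S-conn x∈S w∈S x~w (λ { refl → <-irrefl refl w<x })
      (Childless⇒Pendant x-childless)
      (Childless⇒Pendant (only-child-Childless w≡parent only-child))

L124⇒%3≢0 : ∀ {t} → L124 t → t % 3 ≢ 0
L124⇒%3≢0 (inj₁ refl)        ()
L124⇒%3≢0 (inj₂ (inj₁ refl)) ()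
L124⇒%3≢0 (inj₂ (inj₂ refl)) ()

Spider₁₂ : ℕ → Graph
Spider₁₂ k = SubdividedStar (1 ∷ 2 ∷ k ∷ [])

spider-parent : ℕ → ℕ
spider-parent 3                               = 2
spider-parent (suc (suc (suc (suc (suc j))))) = 4 + j
spider-parent _                               = 0

ArmEdge⇒IsParent : ∀ {k a b} → ArmEdge (1 ∷ 2 ∷ k ∷ []) 1 a b → IsParent spider-parent a b
ArmEdge⇒IsParent (centre _)                             = refl , s≤s z≤n
ArmEdge⇒IsParent (along _ (s≤s ()))
ArmEdge⇒IsParent (later (centre _))                     = refl , s≤s z≤n
ArmEdge⇒IsParent (later (along zero _))                 = refl , ≤-refl
ArmEdge⇒IsParent (later (along (suc _) (s≤s (s≤s ()))))
ArmEdge⇒IsParent (later (later (centre _)))             = refl , s≤s z≤n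
ArmEdge⇒IsParent (later (later (along _ _)))            = refl , ≤-refl
ArmEdge⇒IsParent (later (later (later ())))

parent-ArmEdge : ∀ {k b} → 0 < b → b < n (Spider₁₂ k) →
                 ArmEdge (1 ∷ 2 ∷ k ∷ []) 1 (spider-parent b) b
parent-ArmEdge {b = 1} _ _ = centre (s≤s z≤n)
parent-ArmEdge {b = 2} _ _ = later (centre (s≤s z≤n))
parent-ArmEdge {b = 3} _ _ = later (along 0 (s≤s (s≤s z≤n)))
parent-ArmEdge {k} {b = 4} _ (s≤s (s≤s (s≤s (s≤s 0<k+0)))) =
  later (later (centre (subst (0 <_) (+-identityʳ k) 0<k+0)))
parent-ArmEdge {k} {b = suc (suc (suc (suc (suc j))))} _ (s≤s (s≤s (s≤s (s≤s 1+j<k+0)))) =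
  later (later (along j (subst (suc j <_) (+-identityʳ k) 1+j<k+0)))

3≢spider-parent : ∀ b → 3 ≢ spider-parent b
3≢spider-parent 3                               ()
3≢spider-parent (suc (suc (suc (suc (suc j))))) ()
3≢spider-parent 0                               ()
3≢spider-parent 1                               ()
3≢spider-parent 2                               ()
3≢spider-parent 4                               ()

spider-parent>0 : ∀ {b} → 5 ≤ b → 0 < spider-parent b
spider-parent>0 (s≤s (s≤s (s≤s (s≤s (s≤s _))))) = s≤s z≤n

spider-parent-injective : ∀ b c → spider-parent b ≡ spider-parent c → 0 < spider-parent c → b ≡ c
spider-parent-injective 3 3 _ _ = refl
spider-parent-injective (suc (suc (suc (suc (suc i))))) (suc (suc (suc (suc (suc j))))) eq _ =
  cong (5 +_) (+-cancelˡ-≡ 4 i j eq)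
spider-parent-injective 0 3 () _
spider-parent-injective 1 3 () _
spider-parent-injective 2 3 () _
spider-parent-injective 4 3 () _
spider-parent-injective (suc (suc (suc (suc (suc _))))) 3 () _
spider-parent-injective 0 (suc (suc (suc (suc (suc _))))) () _
spider-parent-injective 1 (suc (suc (suc (suc (suc _))))) () _
spider-parent-injective 2 (suc (suc (suc (suc (suc _))))) () _
spider-parent-injective 3 (suc (suc (suc (suc (suc _))))) () _
spider-parent-injective 4 (suc (suc (suc (suc (suc _))))) () _
spider-parent-injective _ 0 _ ()
spider-parent-injective _ 1 _ ()
spider-parent-injective _ 2 _ ()
spider-parent-injective _ 4 _ ()

-- The vertices of label at most 4 are 0, 1, 2, 3 and, when k > 0, 4.
∣S∣≤4 : ∀ k {S : Subset (n (Spider₁₂ k))} →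
        (∀ {z} → z ∈ S → toℕ z ≤ 4) → suc (suc (suc zero)) ∉ S → ∣ S ∣ ≤ 4
∣S∣≤4 zero    {S} _     _   = ∣p∣≤n S
∣S∣≤4 (suc k) {S} S≤4 3∉S =
  ≤-trans (p⊆q⇒∣p∣≤∣q∣ (λ z∈S → ∈Q _ (S≤4 z∈S) (λ { refl → 3∉S z∈S })))
          (≤-reflexive (cong (4 +_) (∣⊥∣≡0 (k + 0))))
  where
  Q : Subset (n (Spider₁₂ (suc k)))
  Q = inside ∷ inside ∷ inside ∷ outside ∷ inside ∷ ⊥
  ∈Q : ∀ z → toℕ z ≤ 4 → z ≢ suc (suc (suc zero)) → z ∈ Q
  ∈Q zero                              _ _   = here
  ∈Q (suc zero)                        _ _   = there here
  ∈Q (suc (suc zero))                  _ _   = there (there here)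
  ∈Q (suc (suc (suc zero)))            _ z≢3 = contradiction refl z≢3
  ∈Q (suc (suc (suc (suc zero))))      _ _   = there (there (there (there here)))
  ∈Q (suc (suc (suc (suc (suc _))))) (s≤s (s≤s (s≤s (s≤s ())))) _

module Spider (k : ℕ) where

  G : Graph
  G = Spider₁₂ k

  Adj-sym : Symmetric (Adj G)
  Adj-sym (inj₁ e) = inj₂ e
  Adj-sym (inj₂ e) = inj₁ e

  Adj⇒IsParent : ∀ {u v} → Adj G u v →
                 IsParent spider-parent (toℕ u) (toℕ v) ⊎ IsParent spider-parent (toℕ v) (toℕ u)
  Adj⇒IsParent (inj₁ e) = inj₁ (ArmEdge⇒IsParent e)
  Adj⇒IsParent (inj₂ e) = inj₂ (ArmEdge⇒IsParent e)

  open ParentLabelled Adj-sym spider-parent Adj⇒IsParent public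

  descend : ∀ v → toℕ v ≢ 0 → ∃ λ u → u Fin.< v × Adj G u v
  descend v v≢0 =
    fromℕ< p<N , subst (_< toℕ v) (sym p≡) p<v , inj₁ (subst (λ a → ArmEdge _ 1 a (toℕ v)) (sym p≡) edge)
    where
    edge : ArmEdge (1 ∷ 2 ∷ k ∷ []) 1 (spider-parent (toℕ v)) (toℕ v)
    edge = parent-ArmEdge (n≢0⇒n>0 v≢0) (toℕ<n v)
    p<v : spider-parent (toℕ v) < toℕ v
    p<v = proj₂ (ArmEdge⇒IsParent edge)
    p<N : spider-parent (toℕ v) < n G
    p<N = <-trans p<v (toℕ<n v)
    p≡ : toℕ (fromℕ< p<N) ≡ spider-parent (toℕ v)
    p≡ = toℕ-fromℕ< p<N

  cut-pair : ∀ {S} → Connected G S → 5 ≤ ∣ S ∣ → Cut G S 2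
  cut-pair {S} S-conn 5≤∣S∣ with suc (suc (suc zero)) ∈? S
  ... | yes 3∈S =
    cut-leaf-and-parent S-conn 3∈S (≤-trans (s≤s (s≤s z≤n)) 5≤∣S∣)
      (λ {z} _ (3≡parent , _) → 3≢spider-parent (toℕ z) 3≡parent)
      (λ b parent≡2 → spider-parent-injective b 3 parent≡2 (s≤s z≤n))
  ... | no 3∉S with m , m∈S , max ← ∃-maximum (∣p∣>0⇒Nonempty (≤-trans (s≤s z≤n) 5≤∣S∣))
               with toℕ m ≤? 4
  ...   | yes m≤4 = contradiction (∣S∣≤4 k (λ z∈S → ≤-trans (max z∈S) m≤4) 3∉S) (<⇒≱ 5≤∣S∣)
  ...   | no m≰4  =
    cut-leaf-and-parent S-conn m∈S (≤-trans (s≤s (s≤s z≤n)) 5≤∣S∣) (maximum-Childless max)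
      (λ b parent≡ → spider-parent-injective b (toℕ m) parent≡ (spider-parent>0 (≰⇒> m≰4)))

  cut₂ : ∀ {S} → Connected G S → ∣ S ∣ % 3 ≡ 2 → Cut G S 2
  cut₂ {S} S-conn ∣S∣%3≡2 with ∣ S ∣ in ∣S∣≡ | cut-whole S-conn
  ... | 2                             | cut = cut
  ... | suc (suc (suc (suc (suc _)))) | _   =
    cut-pair S-conn (subst (5 ≤_) (sym ∣S∣≡) (s≤s (s≤s (s≤s (s≤s (s≤s z≤n))))))

lemma23 : (k : ℕ) →
    𝒢≡ (SubdividedStar (1 ∷ 2 ∷ k ∷ [])) (n (SubdividedStar (1 ∷ 2 ∷ k ∷ [])) % 3)
    × n (SubdividedStar (1 ∷ 2 ∷ k ∷ [])) % 3 ≡ (k + 4) % 3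
lemma23 k = subst (𝒢≡ G) (cong (_% 3) (∣⊤∣≡n (n G))) grundy-whole , cong (_% 3) N≡k+4
  where
  open Spider k
  grundy-whole : 𝒢≡ G (∣ ⊤ {n G} ∣ % 3)
  grundy-whole = grundy≡∣S∣%3 (inj₁ refl) (inj₂ (inj₁ refl)) L124⇒%3≢0 cut-maximum cut₂
                   (⊤-connected Adj-sym descend)
  N≡k+4 : n G ≡ k + 4
  N≡k+4 = trans (cong (4 +_) (+-identityʳ k)) (+-comm 4 k)
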